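{- Let $\mathscr P$ be a finite poset on $X$. (1) If $a\lessdot b$ is a cover relation in $\mathscr P$, then $\mathcal O(\mathscr P_{a\lessdot b})$ is combinatorially equivalent to the facet wedge of $\mathcal O(\mathscr P)$ along the facet $\{\mathbf t\in\mathcal O(\mathscr P): t_a=t_b\}$. (2) If $c$ is a minimal (respectively maximal) element of $\mathscr P$, then $\mathcal O(\mathscr P_c)$ is combinatorially equivalent to the facet wedge of $\mathcal O(\mathscr P)$ along the facet $\{\mathbf t\in\mathcal O(\mathscr P): t_c=0\}$ (respectively $\{\mathbf t\in\mathcal O(\mathscr P): t_c=1\}$).
   Context: The order polytope is $\mathcal O(\mathscr P)=\{\mathbf t\in\mathbb{R}^X: 0\le t_i\le1,\ t_i\le t_j \text{ if } i\preceq j\}$; its facets are $\{t_i=0\}$ for minimal $i$, $\{t_i=t_j\}$ for covers $i\lessdot j$, and $\{t_i=1\}$ for maximal $i$. $\mathscr P_{a\lessdot b}$ is obtained by adding a new element $*$ and replacing the cover $a\lessdot b$ by $a\lessdot *\lessdot b$. For $c$ maximal (resp. minimal), $\mathscr P_c$ is obtained by adding a new element $*$ and the cover $c\lessdot *$ (resp. $*\lessdot c$). Facet wedge: for a full-dimensional $P\subseteq\mathbb{R}^d$ and facet $F$, $P_F=\mathrm{conv}(\{(v,0): v \text{ a vertex of } P\}\cup\{(v,1): v \text{ a vertex of } P,\ v\notin F\})\subseteq\mathbb{R}^{d+1}$.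
   Formalization: Points have coordinates in ℚ rather than ℝ, and the supporting linear functionals and convex-combination weights are rational, so this applies to the order polytopes, their faces and the facet wedge. -}

module Defs where

open import Data.Nat using (ℕ; zero; suc)
open import Data.Fin using (Fin; zero; suc)
open import Data.Rational using (ℚ; 0ℚ; 1ℚ; _+_; _*_; _≤_)
open import Data.List using (List; []; _∷_)
open import Data.Product using (Σ; Σ-syntax; ∃; ∃-syntax; _×_; _,_)
open import Data.Sum using (_⊎_)
open import Data.Unit using (⊤)
open import Data.Empty using (⊥)
open import Relation.Nullary using (¬_)
open import Relation.Binary.PropositionalEquality using (_≡_; _≢_)
open import Function.Bundles using (_⇔_)

Point : ℕ → Set
Point n = Fin n → ℚ

Region : ℕ → Set₁
Region n = Point n → Set

_≈ₚ_ : ∀ {n} → Point n → Point n → Set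
x ≈ₚ y = ∀ i → x i ≡ y i

dot : ∀ {n} → Point n → Point n → ℚ
dot {zero}  x y = 0ℚ
dot {suc n} x y = x zero * y zero + dot (λ i → x (suc i)) (λ i → y (suc i))

_⊆ᵣ_ : ∀ {n} → Region n → Region n → Set
S ⊆ᵣ T = ∀ x → S x → T x

-- Faces: subsets cut out by a valid linear inequality  c·x ≤ β
-- (includes the empty face and the whole polytope)

record Face {n : ℕ} (S : Region n) : Set where
  constructor face
  field
    normal : Point n
    height : ℚ
    valid  : ∀ x → S x → dot normal x ≤ height

faceSet : ∀ {n} {S : Region n} → Face S → Region n
faceSet {S = S} F x = S x × dot (Face.normal F) x ≡ Face.height F

IsVertex : ∀ {n} → Region n → Point n → Set
IsVertex S v = Σ[ F ∈ Face S ] (∀ x → faceSet F x ⇔ (x ≈ₚ v))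

combine : ∀ {n} → List (ℚ × Point n) → Point n
combine []            i = 0ℚ
combine ((l , p) ∷ r) i = l * p i + combine r i

weights : ∀ {n} → List (ℚ × Point n) → ℚ
weights []            = 0ℚ
weights ((l , p) ∷ r) = l + weights r

AllIn : ∀ {n} → Region n → List (ℚ × Point n) → Set
AllIn V []            = ⊤
AllIn V ((l , p) ∷ r) = (0ℚ ≤ l × V p) × AllIn V r

ConvexHull : ∀ {n} → Region n → Region n
ConvexHull V x = Σ[ cs ∈ List (ℚ × Point _) ]
  (AllIn V cs × weights cs ≡ 1ℚ × x ≈ₚ combine cs)

-- Facet wedge.  The new (last) coordinate is placed at index zero.

tailₚ : ∀ {n} → Point (suc n) → Point n
tailₚ y i = y (suc i)

FacetWedge : ∀ {n} → Region n → Region n → Region (suc n)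
FacetWedge P F = ConvexHull λ y →
    (y zero ≡ 0ℚ × IsVertex P (tailₚ y))
  ⊎ (y zero ≡ 1ℚ × IsVertex P (tailₚ y) × ¬ F (tailₚ y))

-- Combinatorial equivalence: isomorphism of face posets (faces compared
-- as point sets, ordered by inclusion)

SameSet : ∀ {n} → Region n → Region n → Set
SameSet S T = S ⊆ᵣ T × T ⊆ᵣ S

CombEquiv : ∀ {m k} → Region m → Region k → Set
CombEquiv S T =
  Σ[ φ ∈ (Face S → Face T) ] Σ[ ψ ∈ (Face T → Face S) ]
    ((∀ F → SameSet (faceSet (ψ (φ F))) (faceSet F))
   × (∀ G → SameSet (faceSet (φ (ψ G))) (faceSet G))
   × (∀ F F' → (faceSet F ⊆ᵣ faceSet F') ⇔ (faceSet (φ F) ⊆ᵣ faceSet (φ F'))))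

Rel : ℕ → Set₁
Rel n = Fin n → Fin n → Set

Strict : ∀ {n} → Rel n → Rel n
Strict _≼_ a b = a ≼ b × a ≢ b

Covers : ∀ {n} → Rel n → Fin n → Fin n → Set
Covers _≼_ a b = Strict _≼_ a b × (∀ c → ¬ (Strict _≼_ a c × Strict _≼_ c b))

Minimal : ∀ {n} → Rel n → Fin n → Set
Minimal _≼_ c = ∀ i → i ≼ c → i ≡ c

Maximal : ∀ {n} → Rel n → Fin n → Set
Maximal _≼_ c = ∀ i → c ≼ i → i ≡ c

OrderPolytope : ∀ {n} → Rel n → Region n
OrderPolytope _≼_ t = (∀ i → 0ℚ ≤ t i × t i ≤ 1ℚ) × (∀ i j → i ≼ j → t i ≤ t j)

-- Extended posets on Fin (suc n): new element * = zero, old i ↦ suc i.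
-- P_{a⋖b}: a ⋖ * ⋖ b
coverExt : ∀ {n} → Rel n → Fin n → Fin n → Rel (suc n)
coverExt _≼_ a b zero    zero    = ⊤
coverExt _≼_ a b zero    (suc j) = b ≼ j
coverExt _≼_ a b (suc i) zero    = i ≼ a
coverExt _≼_ a b (suc i) (suc j) = i ≼ j

-- P_c for c minimal: * ⋖ c
minExt : ∀ {n} → Rel n → Fin n → Rel (suc n)
minExt _≼_ c zero    zero    = ⊤
minExt _≼_ c zero    (suc j) = c ≼ j
minExt _≼_ c (suc i) zero    = ⊥
minExt _≼_ c (suc i) (suc j) = i ≼ j

-- P_c for c maximal: c ⋖ *
maxExt : ∀ {n} → Rel n → Fin n → Rel (suc n)
maxExt _≼_ c zero    zero    = ⊤
maxExt _≼_ c zero    (suc j) = ⊥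
maxExt _≼_ c (suc i) zero    = i ≼ c
maxExt _≼_ c (suc i) (suc j) = i ≼ j

-- The shear (t_*, t) ↦ (t_* − t_a, t) (with c in place of a in the maximal case, and the
-- identity in the minimal case) is a linear bijection, so it carries faces to faces, and it
-- remains to see that it maps O(P_{a⋖b}) onto the facet wedge. Both sides are convex hulls of
-- 0/1 points: every point of an order polytope is a convex combination of its 0/1 points
-- (peel off the least positive coordinate and recurse), and these are exactly its vertices.
-- The shear matches the 0/1 points of O(P_{a⋖b}) with the generators of the wedge: such a
-- point has t_* = t_a, giving (0, t), or t_a = 0 < t_* = 1 = t_b, giving (1, t) with t ∉ F.
module Submission where

open import Defs
open import Data.Nat using (ℕ)
open import Data.Fin using (Fin)
open import Data.Rational using (0ℚ; 1ℚ)
open import Data.Product using (_×_)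
open import Relation.Binary.PropositionalEquality using (_≡_)
open import Relation.Binary.Structures using (IsPartialOrder)

import Data.Nat as ℕ
import Data.Nat.Properties as ℕ
open import Data.Fin using (zero; suc)
open import Data.Rational using (ℚ; _+_; _*_; _-_; -_; _≤_; _<_; _≟_; _<?_; _≤?_; nonNegative; positive)
open import Data.Rational.Properties
open import Data.Rational.Solver using (module +-*-Solver)
open import Data.List using (List; []; _∷_; map)
open import Data.Product using (Σ-syntax; _,_; proj₁; proj₂; map₂)
open import Data.Sum using (_⊎_; inj₁; inj₂)
open import Data.Unit using (tt)
open import Data.Empty using (⊥-elim)
open import Data.Vec.Functional using (updateAt)
open import Relation.Nullary using (¬_; yes; no)
open import Relation.Binary.PropositionalEquality
  using (_≢_; refl; sym; trans; cong; cong₂; subst; subst₂; module ≡-Reasoning)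
open import Function.Bundles using (mk⇔; Equivalence)
open +-*-Solver

0≤1 : 0ℚ ≤ 1ℚ
0≤1 = nonNegative⁻¹ 1ℚ

1≰0 : ¬ 1ℚ ≤ 0ℚ
1≰0 1≤0 = <-irrefl refl (<-≤-trans (positive⁻¹ 1ℚ) 1≤0)

p≤q⇒0≤q-p : ∀ {p q} → p ≤ q → 0ℚ ≤ q - p
p≤q⇒0≤q-p {p} {q} p≤q = subst (_≤ q - p) (+-inverseʳ p) (+-monoˡ-≤ (- p) p≤q)

≤∧≢⇒< : ∀ {x y} → x ≤ y → x ≢ y → x < y
≤∧≢⇒< x≤y x≢y = ≰⇒> λ y≤x → x≢y (≤-antisym x≤y y≤x)

+-≡-split : ∀ {a b c d} → a ≤ b → c ≤ d → a + c ≡ b + d → a ≡ b × c ≡ d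
+-≡-split a≤b c≤d e =
  ≤-antisym a≤b (≮⇒≥ λ a<b → <-irrefl e (+-mono-<-≤ a<b c≤d)) ,
  ≤-antisym c≤d (≮⇒≥ λ c<d → <-irrefl e (+-mono-≤-< a≤b c<d))

binary-bounds : ∀ {x} → x ≡ 0ℚ ⊎ x ≡ 1ℚ → 0ℚ ≤ x × x ≤ 1ℚ
binary-bounds (inj₁ refl) = ≤-refl , 0≤1
binary-bounds (inj₂ refl) = 0≤1 , ≤-refl

binary-≤-cases : ∀ {x y} → x ≡ 0ℚ ⊎ x ≡ 1ℚ → y ≡ 0ℚ ⊎ y ≡ 1ℚ → x ≤ y → x ≡ y ⊎ (x ≡ 0ℚ × y ≡ 1ℚ)
binary-≤-cases (inj₁ x≡0) (inj₁ y≡0) _   = inj₁ (trans x≡0 (sym y≡0))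
binary-≤-cases (inj₁ x≡0) (inj₂ y≡1) _   = inj₂ (x≡0 , y≡1)
binary-≤-cases (inj₂ x≡1) (inj₁ y≡0) x≤y = ⊥-elim (1≰0 (subst₂ _≤_ x≡1 y≡0 x≤y))
binary-≤-cases (inj₂ x≡1) (inj₂ y≡1) _   = inj₁ (trans x≡1 (sym y≡1))

dot-cong : ∀ {n} {c c' x x' : Point n} → c ≈ₚ c' → x ≈ₚ x' → dot c x ≡ dot c' x'
dot-cong {ℕ.zero}  _    _    = refl
dot-cong {ℕ.suc n} c≈c' x≈x' =
  cong₂ _+_ (cong₂ _*_ (c≈c' zero) (x≈x' zero)) (dot-cong (λ i → c≈c' (suc i)) (λ i → x≈x' (suc i)))

dot-zeroʳ : ∀ {n} (c : Point n) → dot c (λ _ → 0ℚ) ≡ 0ℚ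
dot-zeroʳ {ℕ.zero}  c = refl
dot-zeroʳ {ℕ.suc n} c = cong₂ _+_ (*-zeroʳ (c zero)) (dot-zeroʳ (tailₚ c))

dot-linearʳ : ∀ {n} (c : Point n) l p q → dot c (λ i → l * p i + q i) ≡ l * dot c p + dot c q
dot-linearʳ {ℕ.zero}  c l p q = solve 1 (λ l → con 0ℚ := l :* con 0ℚ :+ con 0ℚ) refl l
dot-linearʳ {ℕ.suc n} c l p q = begin
  c zero * (l * p zero + q zero) + dot (tailₚ c) (λ i → l * p (suc i) + q (suc i))
    ≡⟨ cong (c zero * (l * p zero + q zero) +_) (dot-linearʳ (tailₚ c) l (tailₚ p) (tailₚ q)) ⟩
  c zero * (l * p zero + q zero) + (l * dot (tailₚ c) (tailₚ p) + dot (tailₚ c) (tailₚ q))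
    ≡⟨ solve 6 (λ c₀ l p₀ q₀ D D' → c₀ :* (l :* p₀ :+ q₀) :+ (l :* D :+ D')
                                   := l :* (c₀ :* p₀ :+ D) :+ (c₀ :* q₀ :+ D'))
         refl (c zero) l (p zero) (q zero) (dot (tailₚ c) (tailₚ p)) (dot (tailₚ c) (tailₚ q)) ⟩
  l * dot c p + dot c q ∎
  where open ≡-Reasoning

dot-updateAt : ∀ {n} (c : Point n) k v y → dot (updateAt c k (_+ v)) y ≡ dot c y + v * y k
dot-updateAt {ℕ.suc n} c zero v y =
  solve 4 (λ c₀ v y₀ D → (c₀ :+ v) :* y₀ :+ D := c₀ :* y₀ :+ D :+ v :* y₀)
    refl (c zero) v (y zero) (dot (tailₚ c) (tailₚ y))
dot-updateAt {ℕ.suc n} c (suc k) v y = begin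
  c zero * y zero + dot (updateAt (tailₚ c) k (_+ v)) (tailₚ y)
    ≡⟨ cong (c zero * y zero +_) (dot-updateAt (tailₚ c) k v (tailₚ y)) ⟩
  c zero * y zero + (dot (tailₚ c) (tailₚ y) + v * y (suc k))
    ≡⟨ sym (+-assoc (c zero * y zero) _ _) ⟩
  dot c y + v * y (suc k) ∎
  where open ≡-Reasoning

dot-mono : ∀ {n} (c x y : Point n) → (∀ i → c i * x i ≤ c i * y i) → dot c x ≤ dot c y
dot-mono {ℕ.zero}  c x y _  = ≤-refl
dot-mono {ℕ.suc n} c x y termwise =
  +-mono-≤ (termwise zero) (dot-mono (tailₚ c) (tailₚ x) (tailₚ y) (λ i → termwise (suc i)))

dot-mono-≡ : ∀ {n} (c x y : Point n) → (∀ i → c i * x i ≤ c i * y i) →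
             dot c x ≡ dot c y → ∀ i → c i * x i ≡ c i * y i
dot-mono-≡ {ℕ.suc n} c x y termwise e = λ
  { zero    → proj₁ head-and-tail
  ; (suc i) → dot-mono-≡ (tailₚ c) (tailₚ x) (tailₚ y) termwise-tail (proj₂ head-and-tail) i }
  where
  termwise-tail = λ j → termwise (suc j)
  head-and-tail = +-≡-split (termwise zero) (dot-mono (tailₚ c) (tailₚ x) (tailₚ y) termwise-tail) e

wsum : ∀ {n} → (Point n → ℚ) → List (ℚ × Point n) → ℚ
wsum g []             = 0ℚ
wsum g ((l , p) ∷ cs) = l * g p + wsum g cs

wsum-mono : ∀ {n} {V : Region n} {g h : Point n → ℚ} cs → AllIn V cs →
            (∀ p → V p → g p ≤ h p) → wsum g cs ≤ wsum h cs
wsum-mono []             _                  _   = ≤-refl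
wsum-mono ((l , p) ∷ cs) ((0≤l , p∈) , cs∈) g≤h =
  +-mono-≤ (*-monoˡ-≤-nonNeg l {{nonNegative 0≤l}} (g≤h p p∈)) (wsum-mono cs cs∈ g≤h)

wsum-const : ∀ {n} β (cs : List (ℚ × Point n)) → wsum (λ _ → β) cs ≡ weights cs * β
wsum-const β []             = sym (*-zeroˡ β)
wsum-const β ((l , p) ∷ cs) =
  trans (cong (l * β +_) (wsum-const β cs)) (sym (*-distribʳ-+ β l (weights cs)))

combine-coord : ∀ {n} (cs : List (ℚ × Point n)) i → combine cs i ≡ wsum (λ p → p i) cs
combine-coord []             i = refl
combine-coord ((l , p) ∷ cs) i = cong (l * p i +_) (combine-coord cs i)

dot-combine : ∀ {n} (c : Point n) cs → dot c (combine cs) ≡ wsum (dot c) cs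
dot-combine c []             = dot-zeroʳ c
dot-combine c ((l , p) ∷ cs) =
  trans (dot-linearʳ c l p (combine cs)) (cong (l * dot c p +_) (dot-combine c cs))

wsum-attains : ∀ {n} {V : Region n} (g : Point n → ℚ) β cs → AllIn V cs →
               (∀ p → V p → g p ≤ β) → 0ℚ < weights cs → wsum g cs ≡ weights cs * β →
               Σ[ p ∈ Point n ] (V p × g p ≡ β)
wsum-attains g β [] _ _ 0<0 _ = ⊥-elim (<-irrefl refl 0<0)
wsum-attains g β ((l , p) ∷ cs) ((0≤l , p∈) , cs∈) g≤β 0<w e with g p ≟ β
... | yes gp≡β = p , p∈ , gp≡β
... | no  gp≢β with 0ℚ <? l
...   | yes 0<l = ⊥-elim (<-irrefl (trans e (*-distribʳ-+ β l (weights cs))) sum<)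
  where
  sum< : l * g p + wsum g cs < l * β + weights cs * β
  sum< = +-mono-<-≤ (*-monoʳ-<-pos l {{positive 0<l}} (≤∧≢⇒< (g≤β p p∈) gp≢β))
                    (subst (wsum g cs ≤_) (wsum-const β cs) (wsum-mono cs cs∈ g≤β))
...   | no  l≯0 with ≤-antisym (≮⇒≥ l≯0) 0≤l
...     | refl = wsum-attains g β cs cs∈ g≤β (subst (0ℚ <_) (+-identityˡ (weights cs)) 0<w) tail-average
  where
  open ≡-Reasoning
  tail-average : wsum g cs ≡ weights cs * β
  tail-average = begin
    wsum g cs              ≡⟨ sym (+-identityˡ (wsum g cs)) ⟩
    0ℚ + wsum g cs         ≡⟨ cong (_+ wsum g cs) (sym (*-zeroˡ (g p))) ⟩
    0ℚ * g p + wsum g cs   ≡⟨ e ⟩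
    (0ℚ + weights cs) * β  ≡⟨ cong (_* β) (+-identityˡ (weights cs)) ⟩
    weights cs * β         ∎

hull-face-meets-generators : ∀ {n} {V : Region n} {c : Point n} {β x} → ConvexHull V x →
                             (∀ p → V p → dot c p ≤ β) → dot c x ≡ β →
                             Σ[ p ∈ Point n ] (V p × dot c p ≡ β)
hull-face-meets-generators {c = c} {β} {x} (cs , cs∈ , w≡1 , x≈) c≤β cx≡β =
  wsum-attains (dot c) β cs cs∈ c≤β (subst (0ℚ <_) (sym w≡1) (positive⁻¹ 1ℚ)) (begin
    wsum (dot c) cs    ≡⟨ sym (dot-combine c cs) ⟩
    dot c (combine cs) ≡⟨ dot-cong (λ _ → refl) (λ i → sym (x≈ i)) ⟩
    dot c x            ≡⟨ cx≡β ⟩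
    β                  ≡⟨ sym (*-identityˡ β) ⟩
    1ℚ * β             ≡⟨ cong (_* β) (sym w≡1) ⟩
    weights cs * β     ∎)
  where open ≡-Reasoning

AllIn-map : ∀ {m n} {V : Region m} {W : Region n} (h : Point m → Point n) →
            (∀ p → V p → W (h p)) → ∀ cs → AllIn V cs → AllIn W (map (map₂ h) cs)
AllIn-map h V⇒W []             _                  = tt
AllIn-map h V⇒W ((l , p) ∷ cs) ((0≤l , p∈) , cs∈) = (0≤l , V⇒W p p∈) , AllIn-map h V⇒W cs cs∈

weights-map : ∀ {m n} (h : Point m → Point n) cs → weights (map (map₂ h) cs) ≡ weights cs
weights-map h []             = refl
weights-map h ((l , p) ∷ cs) = cong (l +_) (weights-map h cs)

Binary : ∀ {n} → Point n → Set
Binary u = ∀ i → u i ≡ 0ℚ ⊎ u i ≡ 1ℚ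

BinaryPoint : ∀ {n} → Rel n → Region n
BinaryPoint R u = OrderPolytope R u × Binary u

OrderPolytope-resp : ∀ {n} (R : Rel n) {x y} → x ≈ₚ y → OrderPolytope R x → OrderPolytope R y
OrderPolytope-resp R x≈y (bounds , mono) =
  (λ i → subst (0ℚ ≤_) (x≈y i) (proj₁ (bounds i)) , subst (_≤ 1ℚ) (x≈y i) (proj₂ (bounds i))) ,
  (λ i j i≼j → subst₂ _≤_ (x≈y i) (x≈y j) (mono i j i≼j))

OrderPolytope-convex : ∀ {n} (R : Rel n) → ConvexHull (OrderPolytope R) ⊆ᵣ OrderPolytope R
OrderPolytope-convex R x (cs , cs∈ , w≡1 , x≈) =
  OrderPolytope-resp R (λ i → sym (x≈ i))
    ((λ i → subst₂ _≤_ zero-sum (sym (combine-coord cs i)) (on-hull λ p∈ → proj₁ (proj₁ p∈ i)) ,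
            subst₂ _≤_ (sym (combine-coord cs i)) one-sum (on-hull λ p∈ → proj₂ (proj₁ p∈ i))) ,
     (λ i j i≼j → subst₂ _≤_ (sym (combine-coord cs i)) (sym (combine-coord cs j))
                     (on-hull λ p∈ → proj₂ p∈ i j i≼j)))
  where
  on-hull : ∀ {g h : Point _ → ℚ} → (∀ {p} → OrderPolytope R p → g p ≤ h p) → wsum g cs ≤ wsum h cs
  on-hull g≤h = wsum-mono cs cs∈ (λ p → g≤h)
  zero-sum : wsum (λ _ → 0ℚ) cs ≡ 0ℚ
  zero-sum = trans (wsum-const 0ℚ cs) (*-zeroʳ (weights cs))
  one-sum : wsum (λ _ → 1ℚ) cs ≡ 1ℚ
  one-sum = trans (wsum-const 1ℚ cs) (cong (_* 1ℚ) w≡1)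

isPositive : ℚ → ℕ
isPositive x with 0ℚ <? x
... | yes _ = 1
... | no  _ = 0

isPositive-mono : ∀ {x y} → (0ℚ < x → 0ℚ < y) → isPositive x ℕ.≤ isPositive y
isPositive-mono {x} {y} x>0⇒y>0 with 0ℚ <? x | 0ℚ <? y
... | yes x>0 | no y≯0 = ⊥-elim (y≯0 (x>0⇒y>0 x>0))
... | yes _   | yes _  = ℕ.≤-refl
... | no  _   | _      = ℕ.z≤n

isPositive-mono-< : ∀ {x y} → ¬ 0ℚ < x → 0ℚ < y → isPositive x ℕ.< isPositive y
isPositive-mono-< {x} {y} x≯0 y>0 with 0ℚ <? x | 0ℚ <? y
... | yes x>0 | _      = ⊥-elim (x≯0 x>0)
... | no  _   | no y≯0 = ⊥-elim (y≯0 y>0)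
... | no  _   | yes _  = ℕ.≤-refl

positives : ∀ {n} → Point n → ℕ
positives {ℕ.zero}  t = 0
positives {ℕ.suc n} t = isPositive (t zero) ℕ.+ positives (tailₚ t)

positives-mono : ∀ {n} (w t : Point n) → (∀ i → 0ℚ < w i → 0ℚ < t i) → positives w ℕ.≤ positives t
positives-mono {ℕ.zero}  w t _   = ℕ.z≤n
positives-mono {ℕ.suc n} w t w⇒t =
  ℕ.+-mono-≤ (isPositive-mono (w⇒t zero)) (positives-mono (tailₚ w) (tailₚ t) (λ i → w⇒t (suc i)))

positives-mono-< : ∀ {n} (w t : Point n) → (∀ i → 0ℚ < w i → 0ℚ < t i) →
                   ∀ k → ¬ 0ℚ < w k → 0ℚ < t k → positives w ℕ.< positives t
positives-mono-< {ℕ.suc n} w t w⇒t zero w₀≯0 t₀>0 =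
  ℕ.+-mono-<-≤ (isPositive-mono-< w₀≯0 t₀>0) (positives-mono (tailₚ w) (tailₚ t) (λ i → w⇒t (suc i)))
positives-mono-< {ℕ.suc n} w t w⇒t (suc k) w-k≯0 t-k>0 =
  ℕ.+-mono-≤-< (isPositive-mono (w⇒t zero))
               (positives-mono-< (tailₚ w) (tailₚ t) (λ i → w⇒t (suc i)) k w-k≯0 t-k>0)

minPositive : ∀ {n} (t : Point n) →
              (∀ i → ¬ 0ℚ < t i) ⊎ Σ[ k ∈ Fin n ] (0ℚ < t k × ∀ j → 0ℚ < t j → t k ≤ t j)
minPositive {ℕ.zero}  t = inj₁ λ ()
minPositive {ℕ.suc n} t with minPositive (tailₚ t) | 0ℚ <? t zero
... | inj₁ none | yes t₀>0 = inj₂ (zero , t₀>0 , λ { zero _ → ≤-refl ; (suc j) tⱼ>0 → ⊥-elim (none j tⱼ>0) })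
... | inj₁ none | no  t₀≯0 = inj₁ λ { zero → t₀≯0 ; (suc j) → none j }
... | inj₂ (k , t-k>0 , k-min) | no t₀≯0 =
  inj₂ (suc k , t-k>0 , λ { zero t₀>0 → ⊥-elim (t₀≯0 t₀>0) ; (suc j) tⱼ>0 → k-min j tⱼ>0 })
... | inj₂ (k , t-k>0 , k-min) | yes t₀>0 with t zero ≤? t (suc k)
...   | yes t₀≤tₖ = inj₂ (zero , t₀>0 , λ { zero _ → ≤-refl ; (suc j) tⱼ>0 → ≤-trans t₀≤tₖ (k-min j tⱼ>0) })
...   | no  t₀≰tₖ = inj₂ (suc k , t-k>0 , λ { zero _ → <⇒≤ (≰⇒> t₀≰tₖ) ; (suc j) tⱼ>0 → k-min j tⱼ>0 })

ScaledOrderPolytope : ∀ {n} → Rel n → ℚ → Region n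
ScaledOrderPolytope R s t = (∀ i → 0ℚ ≤ t i × t i ≤ s) × (∀ i j → R i j → t i ≤ t j)

WeightedHull : ∀ {n} → Region n → ℚ → Region n
WeightedHull V s x = Σ[ cs ∈ List (ℚ × Point _) ] (AllIn V cs × weights cs ≡ s × x ≈ₚ combine cs)

-- Peeling off one layer: t = μ · support + rest, where μ is the least positive coordinate of t
-- and support is the 0/1 indicator of the positive coordinates.
module Layer {n} {R : Rel n} {s : ℚ} {t : Point n} (t∈ : ScaledOrderPolytope R s t)
             (k : Fin n) (t-k>0 : 0ℚ < t k) (k-min : ∀ j → 0ℚ < t j → t k ≤ t j) where

  μ : ℚ
  μ = t k

  support : Point n
  support i with 0ℚ <? t i
  ... | yes _ = 1ℚ
  ... | no  _ = 0ℚ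

  rest : Point n
  rest i = t i - μ * support i

  coordinate : ∀ i → (0ℚ < t i × support i ≡ 1ℚ × rest i ≡ t i - μ)
                   ⊎ (t i ≡ 0ℚ × support i ≡ 0ℚ × rest i ≡ 0ℚ)
  coordinate i with 0ℚ <? t i
  ... | yes t-i>0 = inj₁ (t-i>0 , refl , cong (λ x → t i - x) (*-identityʳ μ))
  ... | no  t-i≯0 = inj₂ (t-i≡0 , refl , cong₂ _-_ t-i≡0 (*-zeroʳ μ))
    where t-i≡0 = ≤-antisym (≮⇒≥ t-i≯0) (proj₁ (proj₁ t∈ i))

  positive-upward : ∀ {i j} → R i j → 0ℚ < t i → 0ℚ < t j
  positive-upward {i} {j} i≼j t-i>0 = <-≤-trans t-i>0 (proj₂ t∈ i j i≼j)

  rest-bounds : ∀ i → 0ℚ ≤ rest i × rest i ≤ s - μ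
  rest-bounds i with coordinate i
  ... | inj₁ (t-i>0 , _ , eq) = subst (0ℚ ≤_) (sym eq) (p≤q⇒0≤q-p (k-min i t-i>0)) ,
                                subst (_≤ s - μ) (sym eq) (+-monoˡ-≤ (- μ) (proj₂ (proj₁ t∈ i)))
  ... | inj₂ (_ , _ , eq)     = subst (0ℚ ≤_) (sym eq) ≤-refl ,
                                subst (_≤ s - μ) (sym eq) (p≤q⇒0≤q-p (proj₂ (proj₁ t∈ k)))

  rest∈ : ScaledOrderPolytope R (s - μ) rest
  rest∈ = rest-bounds , mono
    where
    mono : ∀ i j → R i j → rest i ≤ rest j
    mono i j i≼j with coordinate i | coordinate j
    ... | inj₁ (_ , _ , eqᵢ)   | inj₁ (_ , _ , eqⱼ)   =
      subst₂ _≤_ (sym eqᵢ) (sym eqⱼ) (+-monoˡ-≤ (- μ) (proj₂ t∈ i j i≼j))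
    ... | inj₁ (t-i>0 , _ , _) | inj₂ (t-j≡0 , _ , _) = ⊥-elim (<-irrefl (sym t-j≡0) (positive-upward i≼j t-i>0))
    ... | inj₂ (_ , _ , eqᵢ)   | _ = subst (_≤ rest j) (sym eqᵢ) (proj₁ (rest-bounds j))

  support-binary : Binary support
  support-binary i with coordinate i
  ... | inj₁ (_ , eq , _) = inj₂ eq
  ... | inj₂ (_ , eq , _) = inj₁ eq

  support∈ : BinaryPoint R support
  support∈ = ((λ i → binary-bounds (support-binary i)) , mono) , support-binary
    where
    mono : ∀ i j → R i j → support i ≤ support j
    mono i j i≼j with coordinate i | coordinate j
    ... | inj₁ (_ , eqᵢ , _)   | inj₁ (_ , eqⱼ , _)   = subst₂ _≤_ (sym eqᵢ) (sym eqⱼ) ≤-refl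
    ... | inj₁ (t-i>0 , _ , _) | inj₂ (t-j≡0 , _ , _) = ⊥-elim (<-irrefl (sym t-j≡0) (positive-upward i≼j t-i>0))
    ... | inj₂ (_ , eqᵢ , _)   | _ = subst (_≤ support j) (sym eqᵢ) (proj₁ (binary-bounds (support-binary j)))

  t≈layers : ∀ i → t i ≡ μ * support i + rest i
  t≈layers i = solve 2 (λ x y → x := y :+ (x :- y)) refl (t i) (μ * support i)

  fewer-positives : positives rest ℕ.< positives t
  fewer-positives = positives-mono-< rest t rest>0⇒t>0 k rest-k≯0 t-k>0
    where
    rest>0⇒t>0 : ∀ i → 0ℚ < rest i → 0ℚ < t i
    rest>0⇒t>0 i rest-i>0 with coordinate i
    ... | inj₁ (t-i>0 , _ , _) = t-i>0
    ... | inj₂ (_ , _ , eq)    = ⊥-elim (<-irrefl (sym eq) rest-i>0)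
    rest-k≯0 : ¬ 0ℚ < rest k
    rest-k≯0 with coordinate k
    ... | inj₁ (_ , _ , eq) = <-irrefl (sym (trans eq (+-inverseʳ μ)))
    ... | inj₂ (_ , _ , eq) = <-irrefl (sym eq)

scaledOrderPolytope⊆weightedHull : ∀ {n} {R : Rel n} (fuel : ℕ) {s} (t : Point n) → positives t ℕ.≤ fuel →
                                   0ℚ ≤ s → ScaledOrderPolytope R s t → WeightedHull (BinaryPoint R) s t
scaledOrderPolytope⊆weightedHull {R = R} fuel {s} t t≤fuel 0≤s t∈ with minPositive t
... | inj₁ none = (s , λ _ → 0ℚ) ∷ [] , ((0≤s , origin∈) , tt) , +-identityʳ s , t≈0
  where
  origin∈ : BinaryPoint R (λ _ → 0ℚ)
  origin∈ = ((λ _ → ≤-refl , 0≤1) , λ _ _ _ → ≤-refl) , λ _ → inj₁ refl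
  t≈0 : ∀ i → t i ≡ s * 0ℚ + 0ℚ
  t≈0 i = trans (≤-antisym (≮⇒≥ (none i)) (proj₁ (proj₁ t∈ i))) (sym (trans (+-identityʳ _) (*-zeroʳ s)))
... | inj₂ (k , t-k>0 , k-min) = peel fuel t≤fuel
  where
  open Layer t∈ k t-k>0 k-min
  peel : ∀ fuel → positives t ℕ.≤ fuel → WeightedHull (BinaryPoint R) s t
  peel ℕ.zero        bound = ⊥-elim (ℕ.n≮0 (ℕ.<-≤-trans fewer-positives bound))
  peel (ℕ.suc fuel') bound
    with scaledOrderPolytope⊆weightedHull fuel' rest (ℕ.≤-pred (ℕ.<-≤-trans fewer-positives bound))
           (p≤q⇒0≤q-p (proj₂ (proj₁ t∈ k))) rest∈
  ... | cs , cs∈ , w≡s-μ , rest≈ =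
    (μ , support) ∷ cs , ((<⇒≤ t-k>0 , support∈) , cs∈) ,
    trans (cong (μ +_) w≡s-μ) (solve 2 (λ μ s → μ :+ (s :- μ) := s) refl μ s) ,
    λ i → trans (t≈layers i) (cong (μ * support i +_) (rest≈ i))

orderPolytope⊆binaryHull : ∀ {n} (R : Rel n) → OrderPolytope R ⊆ᵣ ConvexHull (BinaryPoint R)
orderPolytope⊆binaryHull R t t∈ = scaledOrderPolytope⊆weightedHull (positives t) t ℕ.≤-refl 0≤1 t∈

-- The normal of the face {v} has coordinate -1 where v is 0 and +1 where v is 1.
sign : ∀ {x : ℚ} → x ≡ 0ℚ ⊎ x ≡ 1ℚ → ℚ
sign (inj₁ _) = - 1ℚ
sign (inj₂ _) = 1ℚ

sign-≤ : ∀ {v x} (v∈ : v ≡ 0ℚ ⊎ v ≡ 1ℚ) → 0ℚ ≤ x → x ≤ 1ℚ → sign v∈ * x ≤ sign v∈ * v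
sign-≤ (inj₁ refl) 0≤x _   = *-monoˡ-≤-nonPos (- 1ℚ) 0≤x
sign-≤ (inj₂ refl) _   x≤1 = *-monoˡ-≤-nonNeg 1ℚ x≤1

sign-injective : ∀ {v x} (v∈ : v ≡ 0ℚ ⊎ v ≡ 1ℚ) → sign v∈ * x ≡ sign v∈ * v → x ≡ v
sign-injective {x = x} (inj₁ refl) e =
  trans (solve 1 (λ x → x := :- con 1ℚ :* (:- con 1ℚ :* x)) refl x) (cong (- 1ℚ *_) e)
sign-injective {x = x} (inj₂ refl) e = trans (sym (*-identityˡ x)) e

binary⇒vertex : ∀ {n} (R : Rel n) {v} → BinaryPoint R v → IsVertex (OrderPolytope R) v
binary⇒vertex R {v} (v∈ , v-bin) = face c (dot c v) (λ x x∈ → dot-mono c x v (termwise x∈)) ,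
                                   λ x → mk⇔ (on-face⇒≈ x) (≈⇒on-face x)
  where
  c : Point _
  c i = sign (v-bin i)
  termwise : ∀ {x} → OrderPolytope R x → ∀ i → c i * x i ≤ c i * v i
  termwise x∈ i = sign-≤ (v-bin i) (proj₁ (proj₁ x∈ i)) (proj₂ (proj₁ x∈ i))
  on-face⇒≈ : ∀ x → OrderPolytope R x × dot c x ≡ dot c v → x ≈ₚ v
  on-face⇒≈ x (x∈ , e) i = sign-injective (v-bin i) (dot-mono-≡ c x v (termwise x∈) e i)
  ≈⇒on-face : ∀ x → x ≈ₚ v → OrderPolytope R x × dot c x ≡ dot c v
  ≈⇒on-face x x≈v = OrderPolytope-resp R (λ i → sym (x≈v i)) v∈ , dot-cong (λ _ → refl) x≈v

-- A vertex is a face of the hull of the 0/1 points, so it contains one of them.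
vertex⇒binary : ∀ {n} (R : Rel n) {v} → IsVertex (OrderPolytope R) v → BinaryPoint R v
vertex⇒binary R {v} (face c β c≤β , on-face⇔≈v)
  with Equivalence.from (on-face⇔≈v v) (λ _ → refl)
... | v∈ , cv≡β with hull-face-meets-generators (orderPolytope⊆binaryHull R v v∈) (λ u u∈ → c≤β u (proj₁ u∈)) cv≡β
... | u , (u∈ , u-bin) , cu≡β = v∈ , λ i → subst (λ x → x ≡ 0ℚ ⊎ x ≡ 1ℚ) (u≈v i) (u-bin i)
  where u≈v = Equivalence.to (on-face⇔≈v u) (u∈ , cu≡β)

record LinearBijection (n : ℕ) : Set where
  field
    to from toᵀ fromᵀ : Point n → Point n
    to-adjoint   : ∀ c x → dot c (to x) ≡ dot (toᵀ c) x
    from-adjoint : ∀ c y → dot c (from y) ≡ dot (fromᵀ c) y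
    from-to      : ∀ x → from (to x) ≈ₚ x
    to-from      : ∀ y → to (from y) ≈ₚ y

sameSet-sameHyperplane : ∀ {n} {S : Region n} (F F' : Face S) →
                         (∀ x → dot (Face.normal F) x ≡ dot (Face.normal F') x) →
                         Face.height F ≡ Face.height F' → SameSet (faceSet F) (faceSet F')
sameSet-sameHyperplane F F' c≡c' β≡β' =
  (λ x (x∈ , e) → x∈ , trans (sym (c≡c' x)) (trans e β≡β')) ,
  (λ x (x∈ , e) → x∈ , trans (c≡c' x) (trans e (sym β≡β')))

module _ {n} (L : LinearBijection n) {S T : Region n}
         (to-maps : ∀ x → S x → T (LinearBijection.to L x))
         (from-maps : ∀ y → T y → S (LinearBijection.from L y)) where
  open LinearBijection L

  pushFace : Face S → Face T
  pushFace (face c β c≤β) = face (fromᵀ c) β λ y y∈ →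
    subst (_≤ β) (from-adjoint c y) (c≤β (from y) (from-maps y y∈))

  pullFace : Face T → Face S
  pullFace (face c β c≤β) = face (toᵀ c) β λ x x∈ →
    subst (_≤ β) (to-adjoint c x) (c≤β (to x) (to-maps x x∈))

  fromᵀ-to : ∀ c x → dot (fromᵀ c) (to x) ≡ dot c x
  fromᵀ-to c x = trans (sym (from-adjoint c (to x))) (dot-cong (λ _ → refl) (from-to x))

  toᵀ-from : ∀ c y → dot (toᵀ c) (from y) ≡ dot c y
  toᵀ-from c y = trans (sym (to-adjoint c (from y))) (dot-cong (λ _ → refl) (to-from y))

  pushFace-⊆ : ∀ F F' → faceSet F ⊆ᵣ faceSet F' → faceSet (pushFace F) ⊆ᵣ faceSet (pushFace F')
  pushFace-⊆ (face c β _) (face c' β' _) F⊆F' y (y∈ , e) =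
    y∈ , trans (sym (from-adjoint c' y))
               (proj₂ (F⊆F' (from y) (from-maps y y∈ , trans (from-adjoint c y) e)))

  pushFace-⊆⁻ : ∀ F F' → faceSet (pushFace F) ⊆ᵣ faceSet (pushFace F') → faceSet F ⊆ᵣ faceSet F'
  pushFace-⊆⁻ (face c β _) (face c' β' _) F⊆F' x (x∈ , e) =
    x∈ , trans (sym (fromᵀ-to c' x)) (proj₂ (F⊆F' (to x) (to-maps x x∈ , trans (fromᵀ-to c x) e)))

  pull-push : ∀ F x → dot (Face.normal (pullFace (pushFace F))) x ≡ dot (Face.normal F) x
  pull-push (face c _ _) x = trans (sym (to-adjoint (fromᵀ c) x)) (fromᵀ-to c x)

  push-pull : ∀ G y → dot (Face.normal (pushFace (pullFace G))) y ≡ dot (Face.normal G) y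
  push-pull (face c _ _) y = trans (sym (from-adjoint (toᵀ c) y)) (toᵀ-from c y)

  linearBijection⇒combEquiv : CombEquiv S T
  linearBijection⇒combEquiv =
    pushFace , pullFace ,
    (λ F → sameSet-sameHyperplane (pullFace (pushFace F)) F (pull-push F) refl) ,
    (λ G → sameSet-sameHyperplane (pushFace (pullFace G)) G (push-pull G) refl) ,
    λ F F' → mk⇔ (pushFace-⊆ F F') (pushFace-⊆⁻ F F')

shear : ∀ {n} → ℚ → Fin n → Point (ℕ.suc n) → Point (ℕ.suc n)
shear α d y = updateAt y zero (_+ α * y (suc d))

shearᵀ : ∀ {n} → ℚ → Fin n → Point (ℕ.suc n) → Point (ℕ.suc n)
shearᵀ α d c = updateAt c (suc d) (_+ α * c zero)

shear-adjoint : ∀ {n} α (d : Fin n) c y → dot c (shear α d y) ≡ dot (shearᵀ α d c) y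
shear-adjoint α d c y = begin
  c zero * (y zero + α * y (suc d)) + dot (tailₚ c) (tailₚ y)
    ≡⟨ solve 5 (λ c₀ y₀ α y' D → c₀ :* (y₀ :+ α :* y') :+ D := c₀ :* y₀ :+ D :+ α :* c₀ :* y')
         refl (c zero) (y zero) α (y (suc d)) (dot (tailₚ c) (tailₚ y)) ⟩
  dot c y + α * c zero * y (suc d)
    ≡⟨ sym (dot-updateAt c (suc d) (α * c zero) y) ⟩
  dot (shearᵀ α d c) y ∎
  where open ≡-Reasoning

shear-cong : ∀ {n} α (d : Fin n) {x y} → x ≈ₚ y → shear α d x ≈ₚ shear α d y
shear-cong α d x≈y zero    = cong₂ (λ x₀ x' → x₀ + α * x') (x≈y zero) (x≈y (suc d))
shear-cong α d x≈y (suc i) = x≈y (suc i)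

shear-cancel : ∀ {n} α β → α + β ≡ 0ℚ → (d : Fin n) → ∀ y → shear β d (shear α d y) ≈ₚ y
shear-cancel α β α+β≡0 d y zero = begin
  y zero + α * y (suc d) + β * y (suc d)
    ≡⟨ solve 4 (λ y₀ α β y' → y₀ :+ α :* y' :+ β :* y' := y₀ :+ (α :+ β) :* y')
         refl (y zero) α β (y (suc d)) ⟩
  y zero + (α + β) * y (suc d)
    ≡⟨ cong (λ γ → y zero + γ * y (suc d)) α+β≡0 ⟩
  y zero + 0ℚ * y (suc d)
    ≡⟨ solve 2 (λ y₀ y' → y₀ :+ con 0ℚ :* y' := y₀) refl (y zero) (y (suc d)) ⟩
  y zero ∎
  where open ≡-Reasoning
shear-cancel α β α+β≡0 d y (suc i) = refl

shearBijection : ∀ {n} α β → α + β ≡ 0ℚ → Fin n → LinearBijection (ℕ.suc n)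
shearBijection α β α+β≡0 d = record
  { to           = shear α d
  ; from         = shear β d
  ; toᵀ          = shearᵀ α d
  ; fromᵀ        = shearᵀ β d
  ; to-adjoint   = shear-adjoint α d
  ; from-adjoint = shear-adjoint β d
  ; from-to      = shear-cancel α β α+β≡0 d
  ; to-from      = shear-cancel β α (trans (+-comm β α) α+β≡0) d
  }

shear-combine : ∀ {n} α (d : Fin n) cs → shear α d (combine cs) ≈ₚ combine (map (map₂ (shear α d)) cs)
shear-combine α d []             zero = solve 1 (λ α → con 0ℚ :+ α :* con 0ℚ := con 0ℚ) refl α
shear-combine α d ((l , p) ∷ cs) zero = begin
  l * p zero + combine cs zero + α * (l * p (suc d) + combine cs (suc d))
    ≡⟨ solve 6 (λ l p₀ C₀ α p' C' → l :* p₀ :+ C₀ :+ α :* (l :* p' :+ C')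
                                    := l :* (p₀ :+ α :* p') :+ (C₀ :+ α :* C'))
         refl l (p zero) (combine cs zero) α (p (suc d)) (combine cs (suc d)) ⟩
  l * (p zero + α * p (suc d)) + (combine cs zero + α * combine cs (suc d))
    ≡⟨ cong (l * (p zero + α * p (suc d)) +_) (shear-combine α d cs zero) ⟩
  l * (p zero + α * p (suc d)) + combine (map (map₂ (shear α d)) cs) zero ∎
  where open ≡-Reasoning
shear-combine α d []             (suc i) = refl
shear-combine α d ((l , p) ∷ cs) (suc i) = cong (l * p (suc i) +_) (shear-combine α d cs (suc i))

ConvexHull-shear : ∀ {n} {V W : Region (ℕ.suc n)} α (d : Fin n) →
                   (∀ p → V p → W (shear α d p)) → ∀ y → ConvexHull V y → ConvexHull W (shear α d y)
ConvexHull-shear α d V⇒W y (cs , cs∈ , w≡1 , y≈) =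
  map (map₂ (shear α d)) cs , AllIn-map (shear α d) V⇒W cs cs∈ ,
  trans (weights-map (shear α d) cs) w≡1 ,
  λ i → trans (shear-cong α d y≈ i) (shear-combine α d cs i)

WedgeVertex : ∀ {n} → Region n → Region n → Region (ℕ.suc n)
WedgeVertex P F y = (y zero ≡ 0ℚ × IsVertex P (tailₚ y))
                  ⊎ (y zero ≡ 1ℚ × IsVertex P (tailₚ y) × ¬ F (tailₚ y))

BinaryWedgeVertex : ∀ {n} → Rel n → Region n → Region (ℕ.suc n)
BinaryWedgeVertex R F y = (y zero ≡ 0ℚ × BinaryPoint R (tailₚ y))
                        ⊎ (y zero ≡ 1ℚ × BinaryPoint R (tailₚ y) × ¬ F (tailₚ y))

binary⇒wedgeVertex : ∀ {n} (R : Rel n) F y → BinaryWedgeVertex R F y → WedgeVertex (OrderPolytope R) F y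
binary⇒wedgeVertex R F y (inj₁ (y₀≡0 , v∈))       = inj₁ (y₀≡0 , binary⇒vertex R v∈)
binary⇒wedgeVertex R F y (inj₂ (y₀≡1 , v∈ , v∉F)) = inj₂ (y₀≡1 , binary⇒vertex R v∈ , v∉F)

wedgeVertex⇒binary : ∀ {n} (R : Rel n) F y → WedgeVertex (OrderPolytope R) F y → BinaryWedgeVertex R F y
wedgeVertex⇒binary R F y (inj₁ (y₀≡0 , v))       = inj₁ (y₀≡0 , vertex⇒binary R v)
wedgeVertex⇒binary R F y (inj₂ (y₀≡1 , v , v∉F)) = inj₂ (y₀≡1 , vertex⇒binary R v , v∉F)

shear-facetWedge : ∀ {n} {P : Rel n} {E : Rel (ℕ.suc n)} {F : Region n} α β → α + β ≡ 0ℚ → (d : Fin n) →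
                   (∀ u → BinaryPoint E u → BinaryWedgeVertex P F (shear α d u)) →
                   (∀ y → BinaryWedgeVertex P F y → OrderPolytope E (shear β d y)) →
                   CombEquiv (OrderPolytope E) (FacetWedge (OrderPolytope P) F)
shear-facetWedge {P = P} {E} {F} α β α+β≡0 d down up =
  linearBijection⇒combEquiv (shearBijection α β α+β≡0 d)
    (λ u u∈ → ConvexHull-shear α d (λ p p∈ → binary⇒wedgeVertex P F (shear α d p) (down p p∈)) u
                (orderPolytope⊆binaryHull E u u∈))
    (λ y y∈ → OrderPolytope-convex E _
                (ConvexHull-shear β d (λ p p∈ → up p (wedgeVertex⇒binary P F p p∈)) y y∈))

orderPolytope-extend : ∀ {n} {E : Rel (ℕ.suc n)} {w : Point (ℕ.suc n)} {x} → w zero ≡ x →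
                       0ℚ ≤ x → x ≤ 1ℚ → OrderPolytope (λ i j → E (suc i) (suc j)) (tailₚ w) →
                       (∀ j → E zero (suc j) → x ≤ w (suc j)) → (∀ i → E (suc i) zero → w (suc i) ≤ x) →
                       OrderPolytope E w
orderPolytope-extend refl 0≤x x≤1 (bounds , mono) above below =
  (λ { zero → 0≤x , x≤1 ; (suc i) → bounds i }) ,
  λ { zero zero _ → ≤-refl ; zero (suc j) → above j ; (suc i) zero → below i ; (suc i) (suc j) → mono i j }

binaryPoint-tail : ∀ {n} {E : Rel (ℕ.suc n)} {u} → BinaryPoint E u →
                   BinaryPoint (λ i j → E (suc i) (suc j)) (tailₚ u)
binaryPoint-tail ((bounds , mono) , u-bin) =
  ((λ i → bounds (suc i)) , (λ i j → mono (suc i) (suc j))) , λ i → u-bin (suc i)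

shear-head-0 : ∀ {n} (d : Fin n) (y : Point (ℕ.suc n)) → y zero ≡ 0ℚ → shear 1ℚ d y zero ≡ y (suc d)
shear-head-0 d y y₀≡0 =
  trans (cong (_+ 1ℚ * y (suc d)) y₀≡0) (solve 1 (λ x → con 0ℚ :+ con 1ℚ :* x := x) refl (y (suc d)))

shear-head-equal : ∀ {n} (d : Fin n) (u : Point (ℕ.suc n)) → u (suc d) ≡ u zero → shear (- 1ℚ) d u zero ≡ 0ℚ
shear-head-equal d u u-d≡u₀ =
  trans (cong (λ x → u zero + - 1ℚ * x) u-d≡u₀) (solve 1 (λ x → x :+ :- con 1ℚ :* x := con 0ℚ) refl (u zero))

shear-by-0 : ∀ {n} (d : Fin n) (y : Point (ℕ.suc n)) → shear 0ℚ d y zero ≡ y zero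
shear-by-0 d y = solve 2 (λ y₀ x → y₀ :+ con 0ℚ :* x := y₀) refl (y zero) (y (suc d))

module _ {n} {_≼_ : Rel n} (≼-po : IsPartialOrder _≡_ _≼_) where
  open IsPartialOrder ≼-po using () renaming (refl to ≼-refl; trans to ≼-trans)

  coverExt-facetWedge : ∀ {a b} → a ≼ b →
    CombEquiv (OrderPolytope (coverExt _≼_ a b))
              (FacetWedge (OrderPolytope _≼_) (λ t → OrderPolytope _≼_ t × t a ≡ t b))
  coverExt-facetWedge {a} {b} a≼b = shear-facetWedge {F = F} (- 1ℚ) 1ℚ refl a down up
    where
    E = coverExt _≼_ a b
    F : Region n
    F t = OrderPolytope _≼_ t × t a ≡ t b

    up : ∀ y → BinaryWedgeVertex _≼_ F y → OrderPolytope E (shear 1ℚ a y)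
    up y (inj₁ (y₀≡0 , (v∈@(bounds , mono) , _))) =
      orderPolytope-extend (shear-head-0 a y y₀≡0) (proj₁ (bounds a)) (proj₂ (bounds a)) v∈
        (λ j b≼j → mono a j (≼-trans a≼b b≼j)) (λ i i≼a → mono i a i≼a)
    up y (inj₂ (y₀≡1 , (v∈@(bounds , mono) , v-bin) , v∉F))
      with binary-≤-cases (v-bin a) (v-bin b) (mono a b a≼b)
    ... | inj₁ v-a≡v-b       = ⊥-elim (v∉F (v∈ , v-a≡v-b))
    ... | inj₂ (v-a≡0 , v-b≡1) =
      orderPolytope-extend (cong₂ (λ s x → s + 1ℚ * x) y₀≡1 v-a≡0) 0≤1 ≤-refl v∈
        (λ j b≼j → subst (_≤ y (suc j)) v-b≡1 (mono b j b≼j)) (λ i _ → proj₂ (bounds i))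

    down : ∀ u → BinaryPoint E u → BinaryWedgeVertex _≼_ F (shear (- 1ℚ) a u)
    down u u∈@((bounds , mono) , u-bin) with binary-≤-cases (u-bin (suc a)) (u-bin zero) (mono (suc a) zero ≼-refl)
    ... | inj₁ u-a≡u₀          = inj₁ (shear-head-equal a u u-a≡u₀ , binaryPoint-tail u∈)
    ... | inj₂ (u-a≡0 , u₀≡1) =
      inj₂ (cong₂ (λ s x → s + - 1ℚ * x) u₀≡1 u-a≡0 , binaryPoint-tail u∈ ,
            λ (_ , u-a≡u-b) → 1≰0 (subst₂ _≤_ u₀≡1 (trans (sym u-a≡u-b) u-a≡0) (mono zero (suc b) ≼-refl)))

  minExt-facetWedge : ∀ c →
    CombEquiv (OrderPolytope (minExt _≼_ c))
              (FacetWedge (OrderPolytope _≼_) (λ t → OrderPolytope _≼_ t × t c ≡ 0ℚ))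
  minExt-facetWedge c = shear-facetWedge {F = F} 0ℚ 0ℚ refl c down up
    where
    E = minExt _≼_ c
    F : Region n
    F t = OrderPolytope _≼_ t × t c ≡ 0ℚ

    up : ∀ y → BinaryWedgeVertex _≼_ F y → OrderPolytope E (shear 0ℚ c y)
    up y (inj₁ (y₀≡0 , (v∈@(bounds , _) , _))) =
      orderPolytope-extend (trans (shear-by-0 c y) y₀≡0) ≤-refl 0≤1 v∈
        (λ j _ → proj₁ (bounds j)) (λ _ ())
    up y (inj₂ (y₀≡1 , (v∈@(_ , mono) , v-bin) , v∉F)) with v-bin c
    ... | inj₁ v-c≡0 = ⊥-elim (v∉F (v∈ , v-c≡0))
    ... | inj₂ v-c≡1 =
      orderPolytope-extend (trans (shear-by-0 c y) y₀≡1) 0≤1 ≤-refl v∈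
        (λ j c≼j → subst (_≤ y (suc j)) v-c≡1 (mono c j c≼j)) (λ _ ())

    down : ∀ u → BinaryPoint E u → BinaryWedgeVertex _≼_ F (shear 0ℚ c u)
    down u u∈@((_ , mono) , u-bin) with u-bin zero
    ... | inj₁ u₀≡0 = inj₁ (trans (shear-by-0 c u) u₀≡0 , binaryPoint-tail u∈)
    ... | inj₂ u₀≡1 =
      inj₂ (trans (shear-by-0 c u) u₀≡1 , binaryPoint-tail u∈ ,
            λ (_ , u-c≡0) → 1≰0 (subst₂ _≤_ u₀≡1 u-c≡0 (mono zero (suc c) ≼-refl)))

  maxExt-facetWedge : ∀ c →
    CombEquiv (OrderPolytope (maxExt _≼_ c))
              (FacetWedge (OrderPolytope _≼_) (λ t → OrderPolytope _≼_ t × t c ≡ 1ℚ))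
  maxExt-facetWedge c = shear-facetWedge {F = F} (- 1ℚ) 1ℚ refl c down up
    where
    E = maxExt _≼_ c
    F : Region n
    F t = OrderPolytope _≼_ t × t c ≡ 1ℚ

    up : ∀ y → BinaryWedgeVertex _≼_ F y → OrderPolytope E (shear 1ℚ c y)
    up y (inj₁ (y₀≡0 , (v∈@(bounds , mono) , _))) =
      orderPolytope-extend (shear-head-0 c y y₀≡0) (proj₁ (bounds c)) (proj₂ (bounds c)) v∈
        (λ _ ()) (λ i i≼c → mono i c i≼c)
    up y (inj₂ (y₀≡1 , (v∈@(bounds , _) , v-bin) , v∉F)) with v-bin c
    ... | inj₂ v-c≡1 = ⊥-elim (v∉F (v∈ , v-c≡1))
    ... | inj₁ v-c≡0 =
      orderPolytope-extend (cong₂ (λ s x → s + 1ℚ * x) y₀≡1 v-c≡0) 0≤1 ≤-refl v∈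
        (λ _ ()) (λ i _ → proj₂ (bounds i))

    down : ∀ u → BinaryPoint E u → BinaryWedgeVertex _≼_ F (shear (- 1ℚ) c u)
    down u u∈@((_ , mono) , u-bin) with binary-≤-cases (u-bin (suc c)) (u-bin zero) (mono (suc c) zero ≼-refl)
    ... | inj₁ u-c≡u₀          = inj₁ (shear-head-equal c u u-c≡u₀ , binaryPoint-tail u∈)
    ... | inj₂ (u-c≡0 , u₀≡1) =
      inj₂ (cong₂ (λ s x → s + - 1ℚ * x) u₀≡1 u-c≡0 , binaryPoint-tail u∈ ,
            λ (_ , u-c≡1) → 1≰0 (subst₂ _≤_ u-c≡1 u-c≡0 ≤-refl))

proposition4p6 : (n : ℕ) (_≼_ : Fin n → Fin n → Set) → IsPartialOrder _≡_ _≼_ →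
    ((a b : Fin n) → Covers _≼_ a b →
      CombEquiv (OrderPolytope (coverExt _≼_ a b))
                (FacetWedge (OrderPolytope _≼_) (λ t → OrderPolytope _≼_ t × t a ≡ t b)))
  × ((c : Fin n) → Minimal _≼_ c →
      CombEquiv (OrderPolytope (minExt _≼_ c))
                (FacetWedge (OrderPolytope _≼_) (λ t → OrderPolytope _≼_ t × t c ≡ 0ℚ)))
  × ((c : Fin n) → Maximal _≼_ c →
      CombEquiv (OrderPolytope (maxExt _≼_ c))
                (FacetWedge (OrderPolytope _≼_) (λ t → OrderPolytope _≼_ t × t c ≡ 1ℚ)))
proposition4p6 n _≼_ ≼-po =
  (λ a b a⋖b → coverExt-facetWedge ≼-po (proj₁ (proj₁ a⋖b))) ,
  (λ c _ → minExt-facetWedge ≼-po c) ,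
  (λ c _ → maxExt-facetWedge ≼-po c)
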